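{- Let $k,m,n$ be integers with $3\leq k\leq \lfloor n/2\rfloor$, $m\geq 2$ and $n\geq 2k$. Then the set $\mathcal S^{(k)}_{m\times n}$ of binary $m\times n$ matrices is non-overlapping: every matrix in $\mathcal S^{(k)}_{m\times n}$ is self non-overlapping, and any two distinct matrices $A,B\in\mathcal S^{(k)}_{m\times n}$ are non-overlapping.
   Context: For a binary string $u$ and a symbol $c\in\{0,1\}$, $c^j$ denotes the string of $j$ consecutive copies of $c$; a string "avoids $0^k$ and $1^k$" if it contains no $k$ consecutive equal symbols. For an $m\times n$ matrix $A$, $A_i$ denotes its $i$-th row, viewed as a string of length $n$. $\mathcal S^{(k)}_{m\times n}$ is the set of binary $m\times n$ matrices $A$ such that: (i) the first row is $A_1=1^{k-1}\,0\,w_1\,1\,0^{k-1}$, where $v_1=0w_11$ is a binary string of length $n-2k+2$ avoiding both $0^k$ and $1^k$; (ii) for $i=2,\dots,m-1$, the row $A_i=v_i$ is a binary string of length $n$ that ends with $0$ and avoids both $0^k$ and $1^k$; (iii) the last row is $A_m=1^k\,v_m\,0^k$, where $v_m$ is a binary string of length $n-2k$ avoiding both $0^k$ and $1^k$. Overlaps: for $m\times n$ matrices $A=(a_{i,j})$, $B=(b_{i,j})$ and a translation vector $(p,q)\in\mathbb Z^2$ with $|p|\le m-1$, $|q|\le n-1$, the control window is the nonempty set of positions $(i,j)$ with $1\le i\le m$, $1\le j\le n$, $1\le i+p\le m$, $1\le j+q\le n$; the window is overlapping if $b_{i,j}=a_{i+p,j+q}$ for all positions in it (i.e. $B$ placed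 on $A$ after translation agrees with $A$ on the common area). Two distinct matrices $A,B$ are non-overlapping if no translation $(p,q)\neq(0,0)$ (in either role, $B$ on $A$ or $A$ on $B$) gives an overlapping window; this covers corner overlaps, full-width vertical shifts and full-height horizontal shifts. A matrix $A$ is self non-overlapping if no translation $(p,q)\neq(0,0)$ of $A$ on itself gives an overlapping window. A set of $m\times n$ matrices is non-overlapping if each of its matrices is self non-overlapping and any two distinct ones are non-overlapping. -}

module Defs where

open import Data.Bool using (Bool; true; false)
open import Data.Nat using (ℕ; zero; suc; _∸_; _<_; _≤_)
open import Data.Fin using (Fin; toℕ)
open import Data.Integer as ℤ using (ℤ; +_; ∣_∣)
open import Data.List using (List; []; _∷_; _++_; replicate; tabulate)
open import Data.Product using (Σ; ∃; _×_; _,_)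
open import Relation.Binary.PropositionalEquality using (_≡_)
open import Relation.Nullary using (¬_)

Mat : ℕ → ℕ → Set
Mat m n = Fin m → Fin n → Bool

row : ∀ {m n} → Mat m n → Fin m → List Bool
row A i = tabulate (A i)

Avoids : ℕ → List Bool → Set
Avoids k w = ¬ (Σ (List Bool) λ u → Σ (List Bool) λ v → Σ Bool λ c →
                  w ≡ u ++ replicate k c ++ v)

FirstRow : ℕ → List Bool → Set
FirstRow k r = Σ (List Bool) λ w₁ →
  (r ≡ replicate (k ∸ 1) true ++ false ∷ w₁ ++ true ∷ replicate (k ∸ 1) false)
  × Avoids k (false ∷ w₁ ++ true ∷ [])

MiddleRow : ℕ → List Bool → Set
MiddleRow k r = (Σ (List Bool) λ u → r ≡ u ++ false ∷ []) × Avoids k r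

LastRow : ℕ → List Bool → Set
LastRow k r = Σ (List Bool) λ v →
  (r ≡ replicate k true ++ v ++ replicate k false) × Avoids k v

-- membership in S^{(k)}_{m×n}  (row index toℕ i = 0 is the paper's row 1,
-- toℕ i = m ∸ 1 is the paper's row m)
InS : (k m n : ℕ) → Mat m n → Set
InS k m n A = ∀ (i : Fin m) →
    (toℕ i ≡ 0 → FirstRow k (row A i))
  × (toℕ i ≡ m ∸ 1 → LastRow k (row A i))
  × (0 < toℕ i → toℕ i < m ∸ 1 → MiddleRow k (row A i))

Overlapping : ∀ {m n} → Mat m n → Mat m n → ℤ → ℤ → Set
Overlapping {m} {n} A B p q =
  ∀ (i i' : Fin m) (j j' : Fin n) →
    + toℕ i' ≡ (+ toℕ i) ℤ.+ p → + toℕ j' ≡ (+ toℕ j) ℤ.+ q →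
    B i j ≡ A i' j'

Translation : ℕ → ℕ → ℤ → ℤ → Set
Translation m n p q = ∣ p ∣ ≤ m ∸ 1 × ∣ q ∣ ≤ n ∸ 1 × ¬ (p ≡ + 0 × q ≡ + 0)

SelfNonOverlapping : ∀ {m n} → Mat m n → Set
SelfNonOverlapping {m} {n} A =
  ∀ (p q : ℤ) → Translation m n p q → ¬ Overlapping A A p q

NonOverlappingPair : ∀ {m n} → Mat m n → Mat m n → Set
NonOverlappingPair {m} {n} A B =
  ∀ (p q : ℤ) → Translation m n p q →
    ¬ Overlapping A B p q × ¬ Overlapping B A p q

NonOverlappingSet : ∀ {m n} → (Mat m n → Set) → Set
NonOverlappingSet {m} {n} S =
    (∀ A → S A → SelfNonOverlapping A)
  × (∀ A B → S A → S B → ¬ (∀ i j → A i j ≡ B i j) → NonOverlappingPair A B)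

module Submission where

-- Write k = K + 1 and n = k + L + k, and read every matrix at
-- natural-number coordinates (0 outside the grid).  A member of S^{(k)} then
-- has a simple "shape" (record Layout.Shape):
--   * the first row starts with 1^K 0, the last row M is 1^k v 0^k, |v| = L;
--   * the last column is 0, since every row ends with 0;
--   * the rows above the last one contain no run of k equal symbols, and
--     the last row has no run of k ones starting in columns k .. k + L.
-- The only real work there is the first row: 1^K 0w1 0^K has no run of
-- length K + 1, because such a run either covers a border 1|0 of the head
-- or of the tail, or lies inside 0w1.
-- Overlaps are excluded from the shape alone.  Up to exchanging the two
-- matrices, a nonzero translation is a shift by (a, b) with a, b ≥ 0 or a
-- skew by (a, -b) with a, b > 0.  In every case either a forbidden run of
-- one matrix is copied into an upper row of the other, or one cell would
-- have to be both 1 and 0 (Layout.Cases).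

open import Defs
open import Data.Nat using (ℕ; _≤_; _*_; _/_)
open import Data.Nat using (zero; suc; _+_; _<_; z≤n; s≤s; s≤s⁻¹; z<s; _<?_; _≤?_; _≟_)
open import Data.Nat.Properties
open import Data.Nat.Tactic.RingSolver using (solve-∀)
open import Data.Bool using (Bool; true; false)
open import Data.Fin using (Fin; toℕ; fromℕ<)
open import Data.Fin.Properties using (toℕ-fromℕ<)
open import Data.Integer as ℤ using (+_; -[1+_])
import Data.Integer.Properties as ℤ
open import Data.List using (List; []; _∷_; _++_; replicate; tabulate; length; take; drop)
open import Data.List.Properties
  using (length-tabulate; length-++; length-replicate; length-drop; take++drop≡id; ++-assoc)
open import Data.Product using (Σ; _,_; proj₁; proj₂)
open import Data.Empty using (⊥)
open import Relation.Nullary using (¬_; yes; no; contradiction)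
open import Relation.Binary.PropositionalEquality
open ≡-Reasoning

contradictory : ∀ {x : Bool} → x ≡ true → x ≡ false → ⊥
contradictory refl ()

-- Strings read at natural-number positions.

-- The j-th symbol of a string; positions past the end read as 0.
at : List Bool → ℕ → Bool
at []       _       = false
at (x ∷ xs) zero    = x
at (x ∷ xs) (suc j) = at xs j

at-++ˡ : ∀ xs ys {j} → j < length xs → at (xs ++ ys) j ≡ at xs j
at-++ˡ (x ∷ xs) ys {zero}  _         = refl
at-++ˡ (x ∷ xs) ys {suc j} (s≤s j<) = at-++ˡ xs ys j<

at-++ʳ : ∀ xs ys j → at (xs ++ ys) (length xs + j) ≡ at ys j
at-++ʳ []       ys j = refl
at-++ʳ (x ∷ xs) ys j = at-++ʳ xs ys j

at-snoc : ∀ u {c} ys → at (u ++ c ∷ ys) (length u) ≡ c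
at-snoc []      ys = refl
at-snoc (x ∷ u) ys = at-snoc u ys

at-replicate : ∀ K c {j} → j < K → at (replicate K c) j ≡ c
at-replicate (suc K) c {zero}  _         = refl
at-replicate (suc K) c {suc j} (s≤s j<) = at-replicate K c j<

at-replicate-++ʳ : ∀ K c ys j → at (replicate K c ++ ys) (K + j) ≡ at ys j
at-replicate-++ʳ zero    c ys j = refl
at-replicate-++ʳ (suc K) c ys j = at-replicate-++ʳ K c ys j

at-drop : ∀ s xs t → at (drop s xs) t ≡ at xs (s + t)
at-drop zero    xs       t = refl
at-drop (suc s) []       t = refl
at-drop (suc s) (x ∷ xs) t = at-drop s xs t

at-tabulate : ∀ {n} (f : Fin n → Bool) {j} (j<n : j < n) → at (tabulate f) j ≡ f (fromℕ< j<n)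
at-tabulate {suc n} f {zero}  _          = refl
at-tabulate {suc n} f {suc j} (s≤s j<n) = at-tabulate (λ i → f (Fin.suc i)) j<n

length-snoc : ∀ (u : List Bool) c → length (u ++ c ∷ []) ≡ suc (length u)
length-snoc u c = trans (length-++ u) (+-comm (length u) 1)

EndsIn0 : List Bool → Set
EndsIn0 r = Σ (List Bool) λ u → r ≡ u ++ false ∷ []

endsIn0-last : ∀ {r N} → EndsIn0 r → length r ≡ suc N → at r N ≡ false
endsIn0-last (u , refl) len =
  subst (λ j → at (u ++ false ∷ []) j ≡ false)
        (suc-injective (trans (sym (length-snoc u false)) len)) (at-snoc u [])

-- Runs.

Run : (ℕ → Bool) → ℕ → ℕ → Bool → Set
Run f s l c = ∀ t → t < l → f (s + t) ≡ c

runAt : ∀ {f s l c x} → Run f s l c → s ≤ x → x < s + l → f x ≡ c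
runAt {s = s} {l} run s≤x x<s+l with m≤n⇒∃[o]m+o≡n s≤x
... | t , refl = run t (+-cancelˡ-< s t l x<s+l)

take-run : ∀ l xs {c} → l ≤ length xs → Run (at xs) 0 l c → take l xs ≡ replicate l c
take-run zero    xs       _         _   = refl
take-run (suc l) (x ∷ xs) (s≤s l≤) run =
  cong₂ _∷_ (run 0 (s≤s z≤n)) (take-run l xs l≤ (λ t t<l → run (suc t) (s≤s t<l)))

-- Avoiding c^k (in the sense of Defs.Avoids) forbids every run of length k:
-- a run is cut out of the string by take and drop.
avoids⇒noRun : ∀ {k r} → Avoids k r → ∀ s c → s + k ≤ length r → ¬ Run (at r) s k c
avoids⇒noRun {k} {r} avoids s c bound run =
  avoids (take s r , drop k (drop s r) , c , decomposition)
  where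
    room : k ≤ length (drop s r)
    room = subst (k ≤_) (sym (length-drop s r))
                 (m+n≤o⇒m≤o∸n k (subst (_≤ length r) (+-comm s k) bound))

    block : take k (drop s r) ≡ replicate k c
    block = take-run k (drop s r) room (λ t t<k → trans (at-drop s r t) (run t t<k))

    decomposition : r ≡ take s r ++ replicate k c ++ drop k (drop s r)
    decomposition = begin
      r                                                   ≡⟨ sym (take++drop≡id s r) ⟩
      take s r ++ drop s r                                ≡⟨ cong (take s r ++_) (sym (take++drop≡id k (drop s r))) ⟩
      take s r ++ take k (drop s r) ++ drop k (drop s r)  ≡⟨ cong (λ b → take s r ++ b ++ drop k (drop s r)) block ⟩
      take s r ++ replicate k c ++ drop k (drop s r)      ∎

-- Bordered strings 1^K v 0^K: the first row of a member of S^{(k)} is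
-- bordered K (0w1) and its last row is bordered k v.
bordered : ℕ → List Bool → List Bool
bordered K v = replicate K true ++ v ++ replicate K false

length-bordered : ∀ K v → length (bordered K v) ≡ K + length v + K
length-bordered K v = begin
  length (bordered K v)                           ≡⟨ length-++ (replicate K true) ⟩
  length (replicate K true) + length (v ++ _)     ≡⟨ cong₂ _+_ (length-replicate K) (length-++ v) ⟩
  K + (length v + length (replicate K false))     ≡⟨ cong (λ z → K + (length v + z)) (length-replicate K) ⟩
  K + (length v + K)                              ≡⟨ sym (+-assoc K (length v) K) ⟩
  K + length v + K                                ∎

bordered-head : ∀ K v {j} → j < K → at (bordered K v) j ≡ true
bordered-head K v {j} j<K =
  trans (at-++ˡ (replicate K true) _ (subst (j <_) (sym (length-replicate K)) j<K))
        (at-replicate K true j<K)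

bordered-body : ∀ K v {j} → j < length v → at (bordered K v) (K + j) ≡ at v j
bordered-body K v {j} j<|v| =
  trans (at-replicate-++ʳ K true _ j) (at-++ˡ v _ j<|v|)

bordered-tail : ∀ K v {x} → K + length v ≤ x → x < K + length v + K → at (bordered K v) x ≡ false
bordered-tail K v x≥ x< with m≤n⇒∃[o]m+o≡n x≥
... | t , refl = begin
  at (bordered K v) (K + length v + t)      ≡⟨ cong (at (bordered K v)) (+-assoc K (length v) t) ⟩
  at (bordered K v) (K + (length v + t))    ≡⟨ at-replicate-++ʳ K true _ _ ⟩
  at (v ++ replicate K false) (length v + t) ≡⟨ at-++ʳ v _ t ⟩
  at (replicate K false) t                   ≡⟨ at-replicate K false (+-cancelˡ-< (K + length v) t K x<) ⟩
  false                                      ∎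

bordered-endsIn0 : ∀ K v → 0 < K → EndsIn0 (bordered K v)
bordered-endsIn0 (suc K) v _ = ones ++ v ++ replicate K false , (begin
  ones ++ v ++ replicate (suc K) false            ≡⟨ cong (λ z → ones ++ v ++ z) (replicate-snoc K) ⟩
  ones ++ v ++ replicate K false ++ false ∷ []    ≡⟨ cong (ones ++_) (sym (++-assoc v _ _)) ⟩
  ones ++ (v ++ replicate K false) ++ false ∷ []  ≡⟨ sym (++-assoc ones _ _) ⟩
  (ones ++ v ++ replicate K false) ++ false ∷ []  ∎)
  where
    ones = replicate (suc K) true
    replicate-snoc : ∀ K → replicate (suc K) false ≡ replicate K false ++ false ∷ []
    replicate-snoc zero    = refl
    replicate-snoc (suc K) = cong (false ∷_) (replicate-snoc K)

run-in-body : ∀ K v {s l c} → Run (at (bordered K v)) (K + s) l c → s + l ≤ length v → Run (at v) s l c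
run-in-body K v {s} {l} {c} run inside t t<l = begin
  at v (s + t)                        ≡⟨ sym (bordered-body K v (<-≤-trans (+-monoʳ-< s t<l) inside)) ⟩
  at (bordered K v) (K + (s + t))     ≡⟨ cong (at (bordered K v)) (sym (+-assoc K s t)) ⟩
  at (bordered K v) (K + s + t)       ≡⟨ run t t<l ⟩
  c                                   ∎

-- A run starting in the body and reaching past it covers the first 0 of the tail.
run-past-body : ∀ K v {s l c} → Run (at (bordered K v)) (K + s) l c →
  s ≤ length v → length v < s + l → s + l ≤ length v + K → c ≡ false
run-past-body K v {s} {l} run s≤|v| past inString =
  trans (sym (runAt {f = at (bordered K v)} run start end)) (bordered-tail K v ≤-refl inTail)
  where
    start : K + s ≤ K + length v
    start = +-monoʳ-≤ K s≤|v|
    end : K + length v < K + s + l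
    end = subst (K + length v <_) (sym (+-assoc K s l)) (+-monoʳ-< K past)
    inTail : K + length v < K + length v + K
    inTail = subst (K + length v <_) (sym (+-assoc K (length v) K))
                   (<-≤-trans (+-monoʳ-< K past) (+-monoʳ-≤ K inString))

core : List Bool → List Bool
core w = false ∷ w ++ true ∷ []

length-core : ∀ w → length (core w) ≡ suc (suc (length w))
length-core w = cong suc (length-snoc w true)

firstRow-break : ∀ K w → at (bordered K (core w)) K ≡ false
firstRow-break K w =
  subst (λ x → at (bordered K (core w)) x ≡ false) (+-identityʳ K) (bordered-body K (core w) z<s)

firstRow-lastOne : ∀ K w → at (bordered K (core w)) (K + suc (length w)) ≡ true
firstRow-lastOne K w =
  trans (bordered-body K (core w) (subst (suc (length w) <_) (sym (length-core w)) ≤-refl))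
        (at-snoc (false ∷ w) [])

-- A run of length K + 1 starting in the head 1^K covers the 1 at its start
-- and the 0 at position K.
firstRow-noRunInHead : ∀ K w {s c} → s < K → ¬ Run (at (bordered K (core w))) s (suc K) c
firstRow-noRunInHead K w {s} {c} s<K run = contradictory c≡true c≡false
  where
    c≡true : c ≡ true
    c≡true = trans (sym (runAt {f = at (bordered K (core w))} run ≤-refl (m<m+n s z<s)))
                   (bordered-head K (core w) s<K)
    c≡false : c ≡ false
    c≡false = trans (sym (runAt {f = at (bordered K (core w))} run (<⇒≤ s<K) (m≤n+m (suc K) s)))
                    (firstRow-break K w)

-- A run of length K + 1 starting in the body either stays inside 0w1, or it
-- covers both the final 1 of 0w1 and the 0 following it.
firstRow-noRunInBody : ∀ K w → Avoids (suc K) (core w) → ∀ s c →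
  K + s + suc K ≤ length (bordered K (core w)) → ¬ Run (at (bordered K (core w))) (K + s) (suc K) c
firstRow-noRunInBody K w avoids s c bound run with s + suc K ≤? length (core w)
... | yes inside = avoids⇒noRun avoids s c inside (run-in-body K (core w) run inside)
... | no past    = contradictory c≡true (run-past-body K (core w) run (<⇒≤ s<|v|) (≰⇒> past) inString)
  where
    ℓ = length w
    inString : s + suc K ≤ length (core w) + K
    inString = +-cancelˡ-≤ K _ _ (subst₂ _≤_ (+-assoc K s (suc K))
      (trans (length-bordered K (core w)) (+-assoc K (length (core w)) K)) bound)
    s<|v| : s < length (core w)
    s<|v| = +-cancelʳ-< K s (length (core w)) (subst (_≤ length (core w) + K) (+-suc s K) inString)
    start : K + s ≤ K + suc ℓ
    start = +-monoʳ-≤ K (s≤s⁻¹ (subst (s <_) (length-core w) s<|v|))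
    end : K + suc ℓ < K + s + suc K
    end = subst (K + suc ℓ <_) (sym (+-assoc K s (suc K)))
            (+-monoʳ-< K (<-trans (subst (suc ℓ <_) (sym (length-core w)) ≤-refl) (≰⇒> past)))
    c≡true : c ≡ true
    c≡true = trans (sym (runAt {f = at (bordered K (core w))} run start end)) (firstRow-lastOne K w)

firstRow-noRun : ∀ K w → Avoids (suc K) (core w) → ∀ s c →
  s + suc K ≤ length (bordered K (core w)) → ¬ Run (at (bordered K (core w))) s (suc K) c
firstRow-noRun K w avoids s c bound with s <? K
... | yes s<K = firstRow-noRunInHead K w s<K
... | no s≮K with m≤n⇒∃[o]m+o≡n (≮⇒≥ s≮K)
...   | s' , refl = firstRow-noRunInBody K w avoids s' c bound

-- The last row 1^K v 0^K with v avoiding runs of length K has no run of K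
-- ones starting at a position K ≤ s ≤ K + |v|: such a run either stays in v
-- or reaches the 0 following v.
lastRow-noOnes : ∀ K v → Avoids K v → ∀ s → K ≤ s → s ≤ K + length v →
  ¬ Run (at (bordered K v)) s K true
lastRow-noOnes K v avoids s K≤s s≤ run with m≤n⇒∃[o]m+o≡n K≤s
... | s' , refl with s' + K ≤? length v
...   | yes inside = avoids⇒noRun avoids s' true inside (run-in-body K v run inside)
...   | no past = contradictory refl (run-past-body K v run s'≤|v| (≰⇒> past) (+-monoˡ-≤ K s'≤|v|))
  where
    s'≤|v| : s' ≤ length v
    s'≤|v| = +-cancelˡ-≤ K s' (length v) s≤

-- Matrices read at natural-number coordinates.

rowAt : ∀ {m n} → Mat m n → ℕ → List Bool
rowAt {m} X i with i <? m
... | yes i<m = row X (fromℕ< i<m)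
... | no _    = []

-- The entry (i, j), 0 outside the matrix.
entry : ∀ {m n} → Mat m n → ℕ → ℕ → Bool
entry X i j = at (rowAt X i) j

rowAt-fromℕ< : ∀ {m n} (X : Mat m n) {i} (i<m : i < m) → rowAt X i ≡ row X (fromℕ< i<m)
rowAt-fromℕ< {m} X {i} i<m with i <? m
... | yes _   = refl
... | no i≮m = contradiction i<m i≮m

length-rowAt : ∀ {m n} (X : Mat m n) {i} → i < m → length (rowAt X i) ≡ n
length-rowAt X {i} i<m = trans (cong length (rowAt-fromℕ< X i<m)) (length-tabulate _)

entry-fromℕ< : ∀ {m n} (X : Mat m n) {i j} (i<m : i < m) (j<n : j < n) →
  entry X i j ≡ X (fromℕ< i<m) (fromℕ< j<n)
entry-fromℕ< X {i} {j} i<m j<n =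
  trans (cong (λ r → at r j) (rowAt-fromℕ< X i<m)) (at-tabulate _ j<n)

overlap-entries : ∀ {m n} {A B : Mat m n} {p q} → Overlapping A B p q →
  ∀ {i i' j j'} → i < m → i' < m → j < n → j' < n →
  + i' ≡ + i ℤ.+ p → + j' ≡ + j ℤ.+ q → entry B i j ≡ entry A i' j'
overlap-entries {A = A} {B} {p} {q} ov i< i'< j< j'< rows cols = begin
  entry B _ _                        ≡⟨ entry-fromℕ< B i< j< ⟩
  B (fromℕ< i<) (fromℕ< j<)          ≡⟨ ov _ _ _ _ (indices {r = p} i< i'< rows) (indices {r = q} j< j'< cols) ⟩
  A (fromℕ< i'<) (fromℕ< j'<)        ≡⟨ sym (entry-fromℕ< A i'< j'<) ⟩
  entry A _ _                        ∎
  where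
    indices : ∀ {N x x' r} (x< : x < N) (x'< : x' < N) → + x' ≡ + x ℤ.+ r →
      + toℕ (fromℕ< x'<) ≡ + toℕ (fromℕ< x<) ℤ.+ r
    indices x< x'< e rewrite toℕ-fromℕ< x< | toℕ-fromℕ< x'< = e

overlap-flip : ∀ {m n} {A B : Mat m n} p q → Overlapping A B p q → Overlapping B A (ℤ.- p) (ℤ.- q)
overlap-flip p q ov i i' j j' rows cols = sym (ov i' i j' j (unshift {r = p} rows) (unshift {r = q} cols))
  where
    unshift : ∀ {x x' r} → x' ≡ x ℤ.+ ℤ.- r → x ≡ x' ℤ.+ r
    unshift {x} {r = r} refl = begin
      x                       ≡⟨ sym (ℤ.+-identityʳ x) ⟩
      x ℤ.+ + 0               ≡⟨ cong (λ y → x ℤ.+ y) (sym (ℤ.+-inverseˡ r)) ⟩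
      x ℤ.+ (ℤ.- r ℤ.+ r)     ≡⟨ sym (ℤ.+-assoc x (ℤ.- r) r) ⟩
      x ℤ.+ ℤ.- r ℤ.+ r       ∎

-- g agrees with f translated by (a, b), a, b ≥ 0, inside an m × n grid.
Shift : ℕ → ℕ → (f g : ℕ → ℕ → Bool) → ℕ → ℕ → Set
Shift m n f g a b = ∀ i j → a + i < m → b + j < n → g i j ≡ f (a + i) (b + j)

-- g agrees with f translated by (a, -b), a, b ≥ 0, inside an m × n grid.
Skew : ℕ → ℕ → (f g : ℕ → ℕ → Bool) → ℕ → ℕ → Set
Skew m n f g a b = ∀ i j → a + i < m → b + j < n → g i (b + j) ≡ f (a + i) j

overlap⇒shift : ∀ {m n} {A B : Mat m n} {a b} → Overlapping A B (+ a) (+ b) →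
  Shift m n (entry A) (entry B) a b
overlap⇒shift {a = a} {b} ov i j ai< bj< =
  overlap-entries {p = + a} {+ b} ov (≤-<-trans (m≤n+m i a) ai<) ai< (≤-<-trans (m≤n+m j b) bj<) bj<
    (cong +_ (+-comm a i)) (cong +_ (+-comm b j))

overlap⇒skew : ∀ {m n} {A B : Mat m n} {a b} → Overlapping A B (+ a) -[1+ b ] →
  Skew m n (entry A) (entry B) a (suc b)
overlap⇒skew {a = a} {b} ov i j ai< bj< =
  overlap-entries {p = + a} { -[1+ b ] } ov (≤-<-trans (m≤n+m i a) ai<) ai< bj< (≤-<-trans (m≤n+m j (suc b)) bj<)
    (cong +_ (+-comm a i)) column
  where
    column : + j ≡ + (suc b + j) ℤ.+ -[1+ b ]
    column = sym (trans (ℤ.⊖-≥ (m≤m+n (suc b) j)) (cong +_ (m+n∸m≡n (suc b) j)))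

-- The shape of a member of S^{(k)} and why it excludes every overlap.
-- Parameters: k = K + 1 is the forbidden run length, the rows are
-- 0, …, M and the columns 0, …, n - 1 with n = k + L + k.
module Layout (K L M : ℕ) where

  k : ℕ
  k = suc K

  n : ℕ
  n = k + L + k

  lastCol : ℕ
  lastCol = k + L + K

  lastCol<n : lastCol < n
  lastCol<n = subst (lastCol <_) (sym (+-suc (k + L) K)) ≤-refl

  <n⇒≤lastCol : ∀ {j} → j < n → j ≤ lastCol
  <n⇒≤lastCol {j} j<n = s≤s⁻¹ (subst (j <_) (+-suc (k + L) K) j<n)

  record Shape (f : ℕ → ℕ → Bool) : Set where
    field
      firstRowHead   : ∀ {j} → j < K → f 0 j ≡ true
      firstRowBreak  : f 0 K ≡ false
      lastColumn     : ∀ {i} → i ≤ M → f i lastCol ≡ false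
      lastRowHead    : ∀ {j} → j < k → f M j ≡ true
      lastRowTail    : ∀ {t} → t < k → f M (k + L + t) ≡ false
      lastRowNoOnes  : ∀ s → k ≤ s → s ≤ k + L → ¬ Run (f M) s k true
      upperRowsAvoid : ∀ {i} → i < M → ∀ s c → s + k ≤ n → ¬ Run (f i) s k c

  module Cases {f g : ℕ → ℕ → Bool} (F : Shape f) (G : Shape g) where
    private
      module F = Shape F
      module G = Shape G

    -- Shifting right past the body: the 1s opening g's first row land on
    -- f's last column, which is 0.
    shift-farRight : ∀ {a b} → a ≤ M → k + L < b → b < n → ¬ Shift (suc M) n f g a b
    shift-farRight {a} {b} a≤M kL<b b<n shift with m≤n⇒∃[o]m+o≡n (<n⇒≤lastCol b<n)
    ... | e , b+e≡ = contradictory (G.firstRowHead e<K) (begin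
          g 0 e            ≡⟨ shift 0 e (s≤s a+0≤M) (subst (_< n) (sym b+e≡) lastCol<n) ⟩
          f (a + 0) (b + e) ≡⟨ cong (f (a + 0)) b+e≡ ⟩
          f (a + 0) lastCol ≡⟨ F.lastColumn a+0≤M ⟩
          false            ∎)
      where
        a+0≤M : a + 0 ≤ M
        a+0≤M = subst (_≤ M) (sym (+-identityʳ a)) a≤M
        e<K : e < K
        e<K = +-cancelˡ-< (k + L) e K (subst (k + L + e <_) b+e≡ (+-monoˡ-< e kL<b))

    -- Shifting down with b ≤ k + L: the 0^k closing f's last row is copied
    -- into the upper row M - a of g.
    shift-downNear : ∀ {a b} → 0 < a → a ≤ M → b ≤ k + L → ¬ Shift (suc M) n f g a b
    shift-downNear {a} {b} 0<a a≤M b≤ shift with m≤n⇒∃[o]m+o≡n a≤M | m≤n⇒∃[o]m+o≡n b≤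
    ... | r , a+r≡M | s , b+s≡ = G.upperRowsAvoid r<M s false room zeros
      where
        r<M : r < M
        r<M = subst (r <_) a+r≡M (m<n+m r 0<a)
        room : s + k ≤ n
        room = +-monoˡ-≤ k (subst (s ≤_) b+s≡ (m≤n+m s b))
        zeros : Run (g r) s k false
        zeros t t<k = begin
          g r (s + t)              ≡⟨ shift r (s + t) (s≤s (≤-reflexive a+r≡M)) inGrid ⟩
          f (a + r) (b + (s + t))  ≡⟨ cong₂ f a+r≡M column ⟩
          f M (k + L + t)          ≡⟨ F.lastRowTail t<k ⟩
          false                    ∎
          where
            column : b + (s + t) ≡ k + L + t
            column = trans (sym (+-assoc b s t)) (cong (_+ t) b+s≡)
            inGrid : b + (s + t) < n
            inGrid = subst (_< n) (sym column) (+-monoʳ-< (k + L) t<k)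

    -- Shifting right by 0 < b ≤ K: the 1s opening g's first row meet the 0
    -- at position K of f's first row.
    shift-rightShort : ∀ {b} → 0 < b → b ≤ K → ¬ Shift (suc M) n f g 0 b
    shift-rightShort {b} 0<b b≤K shift with m≤n⇒∃[o]m+o≡n b≤K
    ... | e , b+e≡K = contradictory (G.firstRowHead e<K)
          (trans (shift 0 e z<s (subst (_< n) (sym b+e≡K) K<n)) (trans (cong (f 0) b+e≡K) F.firstRowBreak))
      where
        e<K : e < K
        e<K = subst (e <_) b+e≡K (m<n+m e 0<b)
        K<n : K < n
        K<n = ≤-trans (m≤m+n k L) (m≤m+n (k + L) k)

    -- Shifting right by k ≤ b ≤ k + L: the 1^k opening g's last row becomes
    -- a run of ones in f's last row starting at b.
    shift-rightNear : ∀ {b} → k ≤ b → b ≤ k + L → ¬ Shift (suc M) n f g 0 b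
    shift-rightNear {b} k≤b b≤ shift = F.lastRowNoOnes b k≤b b≤ ones
      where
        ones : Run (f M) b k true
        ones t t<k = trans (sym (shift M t ≤-refl (+-mono-≤-< b≤ t<k))) (G.lastRowHead t<k)

    -- Skewing by (a, -b) with room for k columns: the 1^k opening f's last
    -- row is copied into the upper row M - a of g.
    skew-wide : ∀ {a b} → 0 < a → a ≤ M → b + k ≤ n → ¬ Skew (suc M) n f g a b
    skew-wide {a} {b} 0<a a≤M room skew with m≤n⇒∃[o]m+o≡n a≤M
    ... | r , a+r≡M = G.upperRowsAvoid (subst (r <_) a+r≡M (m<n+m r 0<a)) b true room ones
      where
        ones : Run (g r) b k true
        ones t t<k = trans (skew r t (s≤s (≤-reflexive a+r≡M)) (<-≤-trans (+-monoʳ-< b t<k) room))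
                           (trans (cong (λ i → f i t) a+r≡M) (F.lastRowHead t<k))

    -- Skewing by (a, -b) with b + k > n: g's last column, which is 0, meets
    -- the 1^k opening f's last row.
    skew-narrow : ∀ {a b} → a ≤ M → b < n → n < b + k → ¬ Skew (suc M) n f g a b
    skew-narrow {a} {b} a≤M b<n n<b+k skew with m≤n⇒∃[o]m+o≡n a≤M | m≤n⇒∃[o]m+o≡n (<n⇒≤lastCol b<n)
    ... | r , a+r≡M | e , b+e≡ = contradictory (F.lastRowHead e<k) (begin
          f M e          ≡⟨ cong (λ i → f i e) (sym a+r≡M) ⟩
          f (a + r) e    ≡⟨ sym (skew r e (s≤s (≤-reflexive a+r≡M)) (subst (_< n) (sym b+e≡) lastCol<n)) ⟩
          g r (b + e)    ≡⟨ cong (g r) b+e≡ ⟩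
          g r lastCol    ≡⟨ G.lastColumn (subst (r ≤_) a+r≡M (m≤n+m r a)) ⟩
          false          ∎)
      where
        e<k : e < k
        e<k = +-cancelˡ-< b e k (subst (_< b + k) (sym b+e≡) (<-trans lastCol<n n<b+k))

    noShiftDown : ∀ {a b} → 0 < a → a ≤ M → b < n → ¬ Shift (suc M) n f g a b
    noShiftDown {b = b} 0<a a≤M b<n with b ≤? k + L
    ... | yes b≤ = shift-downNear 0<a a≤M b≤
    ... | no b≰  = shift-farRight a≤M (≰⇒> b≰) b<n

    noShiftRight : ∀ {b} → 0 < b → b < n → ¬ Shift (suc M) n f g 0 b
    noShiftRight {b} 0<b b<n with b ≤? K | b ≤? k + L
    ... | yes b≤K | _      = shift-rightShort 0<b b≤K
    ... | no b≰K  | yes b≤ = shift-rightNear (≰⇒> b≰K) b≤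
    ... | no _    | no b≰  = shift-farRight z≤n (≰⇒> b≰) b<n

    noSkew : ∀ {a b} → 0 < a → a ≤ M → b < n → ¬ Skew (suc M) n f g a b
    noSkew {b = b} 0<a a≤M b<n with b + k ≤? n
    ... | yes room = skew-wide 0<a a≤M room
    ... | no cramped = skew-narrow a≤M b<n (≰⇒> cramped)

  -- Every member of S^{(k)} has the shape above, provided K ≥ 1 (so that
  -- the first row ends with 0).
  module Membership (K≥1 : 1 ≤ K) {X : Mat (suc M) n} (member : InS k (suc M) n X) where
    firstRow : FirstRow k (rowAt X 0)
    firstRow = subst (FirstRow k) (sym (rowAt-fromℕ< X z<s)) (proj₁ (member (fromℕ< z<s)) refl)

    lastRow : LastRow k (rowAt X M)
    lastRow = subst (LastRow k) (sym (rowAt-fromℕ< X ≤-refl))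
                    (proj₁ (proj₂ (member (fromℕ< ≤-refl))) (toℕ-fromℕ< ≤-refl))

    middleRow : ∀ {i} → 0 < i → i < M → MiddleRow k (rowAt X i)
    middleRow {i} 0<i i<M = subst (MiddleRow k) (sym (rowAt-fromℕ< X i<m))
        (proj₂ (proj₂ (member (fromℕ< i<m))) (subst (0 <_) (sym index) 0<i) (subst (_< M) (sym index) i<M))
      where
        i<m : i < suc M
        i<m = <-trans i<M (n<1+n M)
        index : toℕ (fromℕ< i<m) ≡ i
        index = toℕ-fromℕ< i<m

    w : List Bool
    w = proj₁ firstRow

    firstRow≡ : rowAt X 0 ≡ bordered K (core w)
    firstRow≡ = trans (proj₁ (proj₂ firstRow))
      (cong (λ z → replicate K true ++ false ∷ z) (sym (++-assoc w (true ∷ []) (replicate K false))))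

    v : List Bool
    v = proj₁ lastRow

    lastRow≡ : rowAt X M ≡ bordered k v
    lastRow≡ = proj₁ (proj₂ lastRow)

    |v|≡L : length v ≡ L
    |v|≡L = +-cancelˡ-≡ k _ _ (+-cancelʳ-≡ k _ _
      (trans (sym (length-bordered k v)) (trans (cong length (sym lastRow≡)) (length-rowAt X ≤-refl))))

    endsIn0 : ∀ {i} → i ≤ M → EndsIn0 (rowAt X i)
    endsIn0 {zero}  _ = subst EndsIn0 (sym firstRow≡) (bordered-endsIn0 K (core w) K≥1)
    endsIn0 {suc i} i≤M with suc i ≟ M
    ... | yes i≡M = subst (λ i → EndsIn0 (rowAt X i)) (sym i≡M)
                          (subst EndsIn0 (sym lastRow≡) (bordered-endsIn0 k v z<s))
    ... | no i≢M  = proj₁ (middleRow z<s (≤∧≢⇒< i≤M i≢M))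

    upperRowsAvoid : ∀ {i} → i < M → ∀ s c → s + k ≤ n → ¬ Run (entry X i) s k c
    upperRowsAvoid {zero} _ s c room run =
      firstRow-noRun K w (proj₂ (proj₂ firstRow)) s c
        (subst (s + k ≤_) (trans (sym (length-rowAt X z<s)) (cong length firstRow≡)) room)
        (subst (λ r → Run (at r) s k c) firstRow≡ run)
    upperRowsAvoid {suc i} i<M s c room =
      avoids⇒noRun (proj₂ (middleRow z<s i<M)) s c
        (subst (s + k ≤_) (sym (length-rowAt X (<-trans i<M (n<1+n M)))) room)

    shape : Shape (entry X)
    shape = record
      { firstRowHead   = λ {j} j<K → trans (cong (λ r → at r j) firstRow≡) (bordered-head K (core w) j<K)
      ; firstRowBreak  = trans (cong (λ r → at r K) firstRow≡) (firstRow-break K w)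
      ; lastColumn     = λ i≤M → endsIn0-last (endsIn0 i≤M) (trans (length-rowAt X (s≤s i≤M)) (+-suc (k + L) K))
      ; lastRowHead    = λ {j} j<k → trans (cong (λ r → at r j) lastRow≡) (bordered-head k v j<k)
      ; lastRowTail    = λ {t} t<k → trans (cong (λ r → at r (k + L + t)) lastRow≡)
          (bordered-tail k v (subst (λ ℓ → k + ℓ ≤ k + L + t) (sym |v|≡L) (m≤m+n (k + L) t))
                             (subst (λ ℓ → k + L + t < k + ℓ + k) (sym |v|≡L) (+-monoʳ-< (k + L) t<k)))
      ; lastRowNoOnes  = λ s k≤s s≤ run → lastRow-noOnes k v (proj₂ (proj₂ lastRow)) s k≤s
          (subst (λ ℓ → s ≤ k + ℓ) (sym |v|≡L) s≤) (subst (λ r → Run (at r) s k true) lastRow≡ run)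
      ; upperRowsAvoid = upperRowsAvoid
      }

  -- No nonzero admissible translation makes two matrices of this shape
  -- overlap: up to exchanging them it is a downward shift, a rightward
  -- shift or a skew.
  noOverlap : ∀ {A B : Mat (suc M) n} → Shape (entry A) → Shape (entry B) →
    ∀ p q → Translation (suc M) n p q → ¬ Overlapping A B p q
  noOverlap SA SB (+ zero)  (+ zero)  (_ , _ , nonzero) _ = nonzero (refl , refl)
  noOverlap SA SB (+ zero)  (+ suc b) (_ , b≤ , _) ov =
    Cases.noShiftRight SA SB z<s (s≤s b≤) (overlap⇒shift ov)
  noOverlap SA SB (+ suc a) (+ b)     (a≤ , b≤ , _) ov =
    Cases.noShiftDown SA SB z<s a≤ (s≤s b≤) (overlap⇒shift ov)
  noOverlap SA SB (+ zero)  -[1+ b ]  (_ , b≤ , _) ov =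
    Cases.noShiftRight SB SA z<s (s≤s b≤) (overlap⇒shift (overlap-flip (+ 0) -[1+ b ] ov))
  noOverlap SA SB (+ suc a) -[1+ b ]  (a≤ , b≤ , _) ov =
    Cases.noSkew SA SB z<s a≤ (s≤s b≤) (overlap⇒skew ov)
  noOverlap SA SB -[1+ a ]  (+ zero)  (a≤ , _ , _) ov =
    Cases.noShiftDown SB SA z<s a≤ z<s (overlap⇒shift (overlap-flip -[1+ a ] (+ 0) ov))
  noOverlap SA SB -[1+ a ]  (+ suc b) (a≤ , b≤ , _) ov =
    Cases.noSkew SB SA z<s a≤ (s≤s b≤) (overlap⇒skew (overlap-flip -[1+ a ] (+ suc b) ov))
  noOverlap SA SB -[1+ a ]  -[1+ b ]  (a≤ , b≤ , _) ov =
    Cases.noShiftDown SB SA z<s a≤ (s≤s b≤) (overlap⇒shift (overlap-flip -[1+ a ] -[1+ b ] ov))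

  -- S^{(k)} is non-overlapping for k ≥ 2, m ≥ 1 rows and n = 2k + L columns;
  -- the argument does not even use that the two matrices are distinct.
  nonOverlapping : 1 ≤ K → NonOverlappingSet (InS k (suc M) n)
  nonOverlapping K≥1 =
      (λ A inA p q t → noOverlap (shape inA) (shape inA) p q t)
    , (λ A B inA inB _ p q t → noOverlap (shape inA) (shape inB) p q t , noOverlap (shape inB) (shape inA) p q t)
    where open Membership K≥1 using (shape)

columns : ∀ K L → suc K + L + suc K ≡ 2 * suc K + L
columns = solve-∀

-- The theorem: with k = K + 1 ≥ 3, m = M + 1 ≥ 2 and n = 2k + L columns, S^{(k)}_{m×n} is non-overlapping.
proposition2p4 : (k m n : ℕ) → 3 ≤ k → k ≤ n / 2 → 2 ≤ m → 2 * k ≤ n →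
    NonOverlappingSet {m} {n} (InS k m n)
proposition2p4 zero    _       _ ()         _ _  _
proposition2p4 (suc K) zero    _ _          _ () _
proposition2p4 (suc K) (suc M) n (s≤s 2≤K) _ _  2k≤n with m≤n⇒∃[o]m+o≡n 2k≤n
... | L , 2k+L≡n = subst (λ n → NonOverlappingSet (InS (suc K) (suc M) n)) (trans (columns K L) 2k+L≡n)
                         (Layout.nonOverlapping K L M (≤-trans (s≤s z≤n) 2≤K))
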